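{- Let $k$, $p$, $c$ be integers with $k \geq 0$, $p \geq 1$, $c \geq 3$. Let $G=(V,E)$ be a $k$-FT($pK_c$) graph with $|V|=pc+k$. Then $G$ is $k$-connected.
   Context: All graphs are finite, simple and undirected. For integers $k\ge 0$, $p\ge 1$, $c\ge 2$, a graph $G=(V,E)$ is called $k$-FT($pK_c$) if for every $S\subset V$ with $|S|\le k$, the graph $G-S$ contains as a subgraph the disjoint union of $p$ complete graphs $K_c$. -}

module Defs where

open import Data.Nat using (ℕ; _≤_; _<_)
open import Data.Fin using (Fin)
open import Data.Fin.Subset using (Subset; _∈_; _∉_; ∣_∣)
open import Data.Product using (_×_; _,_; Σ; ∃)
open import Function.Definitions using (Injective)
open import Relation.Binary.PropositionalEquality using (_≡_)
open import Relation.Nullary using (¬_; Dec)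
open import Level using (0ℓ; suc)

record Graph (n : ℕ) : Set₁ where
  field
    Adj    : Fin n → Fin n → Set
    adj?   : ∀ u v → Dec (Adj u v)
    sym    : ∀ {u v} → Adj u v → Adj v u
    irrefl : ∀ {u} → ¬ Adj u u
open Graph public

-- G - S contains p disjoint copies of K_c as a subgraph:
-- an injective map f : Fin p × Fin c → V avoiding S such that
-- f (i , a) and f (i , b) are adjacent whenever a ≢ b.
ContainsPKc : ∀ {n} → Graph n → Subset n → ℕ → ℕ → Set
ContainsPKc {n} G S p c =
  Σ (Fin p × Fin c → Fin n) λ f →
    Injective _≡_ _≡_ f
    × (∀ x → f x ∉ S)
    × (∀ i a b → ¬ a ≡ b → Adj G (f (i , a)) (f (i , b)))

FT : ∀ {n} → ℕ → ℕ → ℕ → Graph n → Set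
FT {n} k p c G = (S : Subset n) → ∣ S ∣ ≤ k → ContainsPKc G S p c

data Reach {n} (G : Graph n) (S : Subset n) (u : Fin n) : Fin n → Set where
  here : Reach G S u u
  step : ∀ {v w} → Reach G S u v → Adj G v w → w ∉ S → Reach G S u w

ConnectedWithout : ∀ {n} → Graph n → Subset n → Set
ConnectedWithout {n} G S = ∀ u v → u ∉ S → v ∉ S → Reach G S u v

KConnected : ∀ {n} → ℕ → Graph n → Set
KConnected {n} k G = (k < n) × ((S : Subset n) → ∣ S ∣ < k → ConnectedWithout G S)

-- Let |S| < k and let A be the vertex set of the component of u in G - S. For any T ⊇ S with
-- |T| = k, the graph G - T has exactly pc vertices, so the pK_c it contains spans it; each
-- clique lies inside A or avoids it, hence c divides |A ∖ T|. If v ∉ A, choose R ⊇ S with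
-- |R| = k - 1 avoiding u and v: T = R ∪ {v} and T = R ∪ {u} give two multiples of c that
-- differ by one, impossible as c > 1.
module Submission where

open import Defs hiding (sym)

open import Data.Empty using (⊥-elim)
open import Data.Fin using (Fin; zero; suc; _≟_; _↑ˡ_; _↑ʳ_; combine; remQuot)
open import Data.Fin.Properties using (suc-injective; 0≢1+n; any?; remQuot-combine; combine-remQuot)
open import Data.Fin.Subset
open import Data.Fin.Subset.Properties
open import Data.Nat using (ℕ; zero; suc; _+_; _*_; _∸_; _≤_; _<_; _≤?_; z≤n; s≤s)
open import Data.Nat.Induction using (<-wellFounded)
open import Data.Nat.Divisibility using (_∣_; _∣0; ∣-refl; ∣m∣n⇒∣m+n; ∣m+n∣m⇒∣n; ∣1⇒≡1)
open import Data.Nat.Properties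
  using (+-suc; +-comm; +-monoˡ-≤; *-mono-≤; ≤-reflexive; >⇒≢; ∸-monoʳ-<; ≤-trans; ≤-pred; ≤-antisym; ≰⇒>; +-monoʳ-≤; +-cancelʳ-≤; m+[n∸m]≡n; m+n∸n≡m; module ≤-Reasoning)
open import Data.Product using (∃; _×_; _,_; uncurry)
open import Data.Sum using (_⊎_; inj₁; inj₂)
open import Data.Vec using ([]; _∷_; _++_; splitAt; here; there; tabulate)
open import Data.Vec.Properties using (lookup∘tabulate; lookup⇒[]=; []=⇒lookup)
open import Function using (_∘_)
open import Function.Definitions using (Injective)
open import Induction.WellFounded using (Acc; acc)
open import Relation.Binary.PropositionalEquality
  using (_≡_; _≢_; refl; cong; sym; trans; subst; module ≡-Reasoning)
open import Relation.Nullary using (yes; no; does)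
open import Relation.Nullary.Decidable using (dec-true; _×-dec_)
open import Relation.Unary using (Pred; Decidable)

private
  variable
    m n : ℕ

∣p++q∣≡∣p∣+∣q∣ : (p : Subset m) (q : Subset n) → ∣ p ++ q ∣ ≡ ∣ p ∣ + ∣ q ∣
∣p++q∣≡∣p∣+∣q∣ []            q = refl
∣p++q∣≡∣p∣+∣q∣ (outside ∷ p) q = ∣p++q∣≡∣p∣+∣q∣ p q
∣p++q∣≡∣p∣+∣q∣ (inside  ∷ p) q = cong suc (∣p++q∣≡∣p∣+∣q∣ p q)

∈-++⁺ˡ : ∀ {x} {p : Subset m} {q : Subset n} → x ∈ p → x ↑ˡ n ∈ p ++ q
∈-++⁺ˡ here      = here
∈-++⁺ˡ (there x∈p) = there (∈-++⁺ˡ x∈p)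

∈-++⁻ˡ : ∀ {x} (p : Subset m) {q : Subset n} → x ↑ˡ n ∈ p ++ q → x ∈ p
∈-++⁻ˡ {x = zero}  (_ ∷ p) here          = here
∈-++⁻ˡ {x = suc x} (_ ∷ p) (there x∈pq) = there (∈-++⁻ˡ p x∈pq)

∈-++⁺ʳ : ∀ {x} (p : Subset m) {q : Subset n} → x ∈ q → m ↑ʳ x ∈ p ++ q
∈-++⁺ʳ []      x∈q = x∈q
∈-++⁺ʳ (_ ∷ p) x∈q = there (∈-++⁺ʳ p x∈q)

∈-++⁻ʳ : ∀ {x} (p : Subset m) {q : Subset n} → m ↑ʳ x ∈ p ++ q → x ∈ q
∈-++⁻ʳ []      x∈pq         = x∈pq
∈-++⁻ʳ (_ ∷ p) (there x∈pq) = ∈-++⁻ʳ p x∈pq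

x∈p─q⇒x∉q : ∀ {x} {p q : Subset n} → x ∈ p ─ q → x ∉ q
x∈p─q⇒x∉q {p = _ ∷ _} {inside ∷ _} ()            here
x∈p─q⇒x∉q {p = _ ∷ _} {_ ∷ _}      (there x∈p─q) (there x∈q) = x∈p─q⇒x∉q x∈p─q x∈q

x∉p⇒p-x≡p : ∀ {x} {p : Subset n} → x ∉ p → p - x ≡ p
x∉p⇒p-x≡p {x = zero}  {outside ∷ p} _   = cong (outside ∷_) (p─⊥≡p p)
x∉p⇒p-x≡p {x = zero}  {inside  ∷ p} x∉p = ⊥-elim (x∉p here)
x∉p⇒p-x≡p {x = suc x} {b ∷ p}       x∉p = cong (b ∷_) (x∉p⇒p-x≡p (λ x∈p → x∉p (there x∈p)))

x∈p⇒suc∣p-x∣≡∣p∣ : ∀ {x} {p : Subset n} → x ∈ p → suc ∣ p - x ∣ ≡ ∣ p ∣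
x∈p⇒suc∣p-x∣≡∣p∣ {p = inside ∷ p}  here         = cong suc (cong ∣_∣ (p─⊥≡p p))
x∈p⇒suc∣p-x∣≡∣p∣ {p = outside ∷ p} (there x∈p) = x∈p⇒suc∣p-x∣≡∣p∣ x∈p
x∈p⇒suc∣p-x∣≡∣p∣ {p = inside ∷ p}  (there x∈p) = cong suc (x∈p⇒suc∣p-x∣≡∣p∣ x∈p)

x∉p⇒∣⁅x⁆∪p∣≡suc∣p∣ : ∀ {x} {p : Subset n} → x ∉ p → ∣ ⁅ x ⁆ ∪ p ∣ ≡ suc ∣ p ∣
x∉p⇒∣⁅x⁆∪p∣≡suc∣p∣ {x = zero}  {outside ∷ p} _   = cong suc (cong ∣_∣ (∪-identityˡ p))
x∉p⇒∣⁅x⁆∪p∣≡suc∣p∣ {x = zero}  {inside  ∷ p} x∉p = ⊥-elim (x∉p here)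
x∉p⇒∣⁅x⁆∪p∣≡suc∣p∣ {x = suc x} {outside ∷ p} x∉p = x∉p⇒∣⁅x⁆∪p∣≡suc∣p∣ (λ x∈p → x∉p (there x∈p))
x∉p⇒∣⁅x⁆∪p∣≡suc∣p∣ {x = suc x} {inside  ∷ p} x∉p = cong suc (x∉p⇒∣⁅x⁆∪p∣≡suc∣p∣ (λ x∈p → x∉p (there x∈p)))

∣p─q∣+∣∁p─q∣≡∣∁q∣ : (p q : Subset n) → ∣ p ─ q ∣ + ∣ ∁ p ─ q ∣ ≡ ∣ ∁ q ∣
∣p─q∣+∣∁p─q∣≡∣∁q∣ []            []            = refl
∣p─q∣+∣∁p─q∣≡∣∁q∣ (_       ∷ p) (inside  ∷ q) = ∣p─q∣+∣∁p─q∣≡∣∁q∣ p q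
∣p─q∣+∣∁p─q∣≡∣∁q∣ (inside  ∷ p) (outside ∷ q) = cong suc (∣p─q∣+∣∁p─q∣≡∣∁q∣ p q)
∣p─q∣+∣∁p─q∣≡∣∁q∣ (outside ∷ p) (outside ∷ q) =
  trans (+-suc ∣ p ─ q ∣ ∣ ∁ p ─ q ∣) (cong suc (∣p─q∣+∣∁p─q∣≡∣∁q∣ p q))

p─⁅x⁆∪q≡p─q-x : (p : Subset n) (x : Fin n) (q : Subset n) → p ─ (⁅ x ⁆ ∪ q) ≡ p ─ q - x
p─⁅x⁆∪q≡p─q-x p x q = trans (sym (p─q─r≡p─q∪r p ⁅ x ⁆ q)) (p─q─r≡p─r─q p ⁅ x ⁆ q)

⊆-interpolate : (p q : Subset n) (j : ℕ) → p ⊆ q → ∣ p ∣ ≤ j → j ≤ ∣ q ∣ →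
                ∃ λ r → p ⊆ r × r ⊆ q × ∣ r ∣ ≡ j
⊆-interpolate []            []            zero    _   _   _   = [] , (λ ()) , (λ ()) , refl
⊆-interpolate (inside ∷ p)  (outside ∷ q) _       p⊆q _   _   with () ← p⊆q here
⊆-interpolate (inside ∷ p)  (inside ∷ q)  (suc j) p⊆q (s≤s lo) (s≤s hi)
  with r , p⊆r , r⊆q , ∣r∣≡j ← ⊆-interpolate p q j (drop-∷-⊆ p⊆q) lo hi
  = inside ∷ r , in⊆in p⊆r , in⊆in r⊆q , cong suc ∣r∣≡j
⊆-interpolate (outside ∷ p) (outside ∷ q) j       p⊆q lo  hi
  with r , p⊆r , r⊆q , ∣r∣≡j ← ⊆-interpolate p q j (drop-∷-⊆ p⊆q) lo hi
  = outside ∷ r , s⊆s p⊆r , s⊆s r⊆q , ∣r∣≡j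
⊆-interpolate (outside ∷ p) (inside ∷ q)  j       p⊆q lo  hi with j ≤? ∣ q ∣
... | yes j≤∣q∣
  with r , p⊆r , r⊆q , ∣r∣≡j ← ⊆-interpolate p q j (drop-∷-⊆ p⊆q) lo j≤∣q∣
  = outside ∷ r , s⊆s p⊆r , out⊆ r⊆q , ∣r∣≡j
⊆-interpolate (outside ∷ p) (inside ∷ q)  zero    p⊆q lo  hi | no j≰∣q∣ = ⊥-elim (j≰∣q∣ z≤n)
⊆-interpolate (outside ∷ p) (inside ∷ q)  (suc j) p⊆q lo  (s≤s hi) | no j≰∣q∣
  with r , p⊆r , r⊆q , ∣r∣≡j ← ⊆-interpolate p q j (drop-∷-⊆ p⊆q)
                                     (≤-trans (p⊆q⇒∣p∣≤∣q∣ (drop-∷-⊆ p⊆q)) (≤-pred (≰⇒> j≰∣q∣))) hi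
  = inside ∷ r , out⊆ p⊆r , in⊆in r⊆q , cong suc ∣r∣≡j

⊥-or-⊤ : (q : Subset n) → (∀ a b → a ∈ q → b ∈ q) → q ≡ ⊥ ⊎ q ≡ ⊤
⊥-or-⊤ q homogeneous with nonempty? q
... | yes (a , a∈q) = inj₂ (⊆-antisym ⊆⊤ (λ {b} _ → homogeneous a b a∈q))
... | no  ¬nonempty = inj₁ (Empty-unique ¬nonempty)

∣∣-blocks : ∀ p {c} (q : Subset (p * c)) →
            (∀ (i : Fin p) (a b : Fin c) → combine i a ∈ q → combine i b ∈ q) → c ∣ ∣ q ∣
∣∣-blocks zero {c} [] _ = c ∣0
∣∣-blocks (suc p) {c} q closed with splitAt c q
... | q₁ , q₂ , refl = subst (c ∣_) (sym (∣p++q∣≡∣p∣+∣q∣ q₁ q₂)) (∣m∣n⇒∣m+n c∣∣q₁∣ c∣∣q₂∣)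
  where
  c∣∣q₁∣ : c ∣ ∣ q₁ ∣
  c∣∣q₁∣ with ⊥-or-⊤ q₁ (λ a b a∈q₁ → ∈-++⁻ˡ q₁ (closed zero a b (∈-++⁺ˡ a∈q₁)))
  ... | inj₁ refl = subst (c ∣_) (sym (∣⊥∣≡0 c)) (c ∣0)
  ... | inj₂ refl = subst (c ∣_) (sym (∣⊤∣≡n c)) ∣-refl
  c∣∣q₂∣ : c ∣ ∣ q₂ ∣
  c∣∣q₂∣ = ∣∣-blocks p q₂ (λ i a b a∈q₂ → ∈-++⁻ʳ q₁ (closed (suc i) a b (∈-++⁺ʳ q₁ a∈q₂)))

select : ∀ {ℓ} {P : Pred (Fin n) ℓ} → Decidable P → Subset n
select P? = tabulate (λ x → does (P? x))

module _ {ℓ} {P : Pred (Fin n) ℓ} (P? : Decidable P) where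

  ∈-select⁺ : ∀ {x} → P x → x ∈ select P?
  ∈-select⁺ {x} px = lookup⇒[]= x _ (trans (lookup∘tabulate _ x) (dec-true (P? x) px))

  ∈-select⁻ : ∀ {x} → x ∈ select P? → P x
  ∈-select⁻ {x} x∈ with P? x | trans (sym (lookup∘tabulate _ x)) ([]=⇒lookup x∈)
  ... | yes px | _  = px
  ... | no  _  | ()

preimage : (Fin m → Fin n) → Subset n → Subset m
preimage g q = select (λ i → g i ∈? q)

module _ {g : Fin m → Fin n} {q : Subset n} {i : Fin m} where

  ∈-preimage⁺ : g i ∈ q → i ∈ preimage g q
  ∈-preimage⁺ = ∈-select⁺ (λ j → g j ∈? q)

  ∈-preimage⁻ : i ∈ preimage g q → g i ∈ q
  ∈-preimage⁻ = ∈-select⁻ (λ j → g j ∈? q)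

∣preimage∣≤∣q∣ : {g : Fin m → Fin n} → Injective _≡_ _≡_ g → ∀ q → ∣ preimage g q ∣ ≤ ∣ q ∣
∣preimage∣≤∣q∣ {zero}  g-inj q = z≤n
∣preimage∣≤∣q∣ {suc m} {g = g} g-inj q with g zero ∈? q
... | no  _     = ∣preimage∣≤∣q∣ (λ e → suc-injective (g-inj e)) q
... | yes g₀∈q = begin-strict
  ∣ preimage (g ∘ suc) q ∣           ≤⟨ p⊆q⇒∣p∣≤∣q∣ preimage⊆ ⟩
  ∣ preimage (g ∘ suc) (q - g zero) ∣ ≤⟨ ∣preimage∣≤∣q∣ (λ e → suc-injective (g-inj e)) (q - g zero) ⟩
  ∣ q - g zero ∣                      <⟨ x∈p⇒∣p-x∣<∣p∣ g₀∈q ⟩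
  ∣ q ∣                               ∎
  where
  open ≤-Reasoning
  preimage⊆ : preimage (g ∘ suc) q ⊆ preimage (g ∘ suc) (q - g zero)
  preimage⊆ i∈ = ∈-preimage⁺ {g = g ∘ suc}
    (x∈p∧x≢y⇒x∈p-y (∈-preimage⁻ {g = g ∘ suc} i∈) (λ e → 0≢1+n (sym (g-inj e))))

∣p∣+∣∁p∣≡n : (p : Subset n) → ∣ p ∣ + ∣ ∁ p ∣ ≡ n
∣p∣+∣∁p∣≡n p = trans (cong (∣ p ∣ +_) (∣∁p∣≡n∸∣p∣ p)) (m+[n∸m]≡n (∣p∣≤n p))

m≤o⇒n≤p⇒m+n≡o+p⇒m≡o : ∀ {m n o p} → m ≤ o → n ≤ p → m + n ≡ o + p → m ≡ o
m≤o⇒n≤p⇒m+n≡o+p⇒m≡o {m} {n} {o} {p} m≤o n≤p eq = ≤-antisym m≤o (+-cancelʳ-≤ p o m (begin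
  o + p ≡⟨ sym eq ⟩
  m + n ≤⟨ +-monoʳ-≤ m n≤p ⟩
  m + p ∎))
  where open ≤-Reasoning

-- m + ∣ t ∣ ≡ n forces the injection g onto the complement of t.
∣preimage∣≡∣q─t∣ : {g : Fin m → Fin n} → Injective _≡_ _≡_ g → {t : Subset n} →
                   (∀ i → g i ∉ t) → m + ∣ t ∣ ≡ n → ∀ q → ∣ preimage g q ∣ ≡ ∣ q ─ t ∣
∣preimage∣≡∣q─t∣ {m} {n} {g} g-inj {t} g∉t m+∣t∣≡n q = m≤o⇒n≤p⇒m+n≡o+p⇒m≡o
  (≤-trans (p⊆q⇒∣p∣≤∣q∣ inside⊆) (∣preimage∣≤∣q∣ g-inj (q ─ t)))
  (≤-trans (p⊆q⇒∣p∣≤∣q∣ outside⊆) (∣preimage∣≤∣q∣ g-inj (∁ q ─ t)))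
  (begin
    ∣ preimage g q ∣ + ∣ ∁ (preimage g q) ∣ ≡⟨ ∣p∣+∣∁p∣≡n (preimage g q) ⟩
    m                                     ≡⟨ sym (m+n∸n≡m m ∣ t ∣) ⟩
    m + ∣ t ∣ ∸ ∣ t ∣                       ≡⟨ cong (_∸ ∣ t ∣) m+∣t∣≡n ⟩
    n ∸ ∣ t ∣                               ≡⟨ sym (∣∁p∣≡n∸∣p∣ t) ⟩
    ∣ ∁ t ∣                                 ≡⟨ sym (∣p─q∣+∣∁p─q∣≡∣∁q∣ q t) ⟩
    ∣ q ─ t ∣ + ∣ ∁ q ─ t ∣                   ∎)
  where
  open ≡-Reasoning
  inside⊆ : preimage g q ⊆ preimage g (q ─ t)
  inside⊆ {i} i∈ = ∈-preimage⁺ {g = g} (x∈p∧x∉q⇒x∈p─q (∈-preimage⁻ {g = g} i∈) (g∉t i))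
  outside⊆ : ∁ (preimage g q) ⊆ preimage g (∁ q ─ t)
  outside⊆ {i} i∈ = ∈-preimage⁺ {g = g}
    (x∈p∧x∉q⇒x∈p─q (x∉p⇒x∈∁p (λ gi∈q → x∈∁p⇒x∉p i∈ (∈-preimage⁺ {g = g} gi∈q))) (g∉t i))

∃-⊇-avoiding : ∀ {k} {S : Subset n} {u v} → ∣ S ∣ < k → k < n → u ∉ S → v ∉ S → u ≢ v →
               ∃ λ R → S ⊆ R × u ∉ R × v ∉ R × suc ∣ R ∣ ≡ k
∃-⊇-avoiding {n} {suc k} {S} {u} {v} (s≤s ∣S∣≤k) k<n u∉S v∉S u≢v =
  avoiding (⊆-interpolate S Q k S⊆Q ∣S∣≤k k≤∣Q∣)
  where
  Q : Subset n
  Q = ⊤ - u - v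
  2+∣Q∣≡n : suc (suc ∣ Q ∣) ≡ n
  2+∣Q∣≡n = trans (cong suc (x∈p⇒suc∣p-x∣≡∣p∣ (x∈p∧x≢y⇒x∈p-y ∈⊤ (u≢v ∘ sym))))
                  (trans (x∈p⇒suc∣p-x∣≡∣p∣ (∈⊤ {x = u})) (∣⊤∣≡n n))
  k≤∣Q∣ : k ≤ ∣ Q ∣
  k≤∣Q∣ = ≤-pred (≤-pred (subst (suc (suc k) ≤_) (sym 2+∣Q∣≡n) k<n))
  S⊆Q : S ⊆ Q
  S⊆Q x∈S = x∈p∧x≢y⇒x∈p-y (x∈p∧x≢y⇒x∈p-y ∈⊤ (λ { refl → u∉S x∈S })) (λ { refl → v∉S x∈S })
  avoiding : (∃ λ R → S ⊆ R × R ⊆ Q × ∣ R ∣ ≡ k) → ∃ λ R → S ⊆ R × u ∉ R × v ∉ R × suc ∣ R ∣ ≡ suc k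
  avoiding (R , S⊆R , R⊆Q , ∣R∣≡k) =
    R , S⊆R , (λ u∈R → x∈p─q⇒x∉q (p─q⊆p _ _ (R⊆Q u∈R)) (x∈⁅x⁆ u))
      , (λ v∈R → x∈p─q⇒x∉q (R⊆Q v∈R) (x∈⁅x⁆ v)) , cong suc ∣R∣≡k

inflationary-closure : (F : Subset n → Subset n) → (∀ {p} → p ⊆ F p) →
                       ∀ {ℓ} (P : Subset n → Set ℓ) → (∀ {p} → P p → P (F p)) →
                       ∀ {p} → P p → ∃ λ q → P q × F q ⊆ q
inflationary-closure {n} F F-inflationary P P-preserved {p} Pp = go p (<-wellFounded (n ∸ ∣ p ∣)) Pp
  where
  go : ∀ p → Acc _<_ (n ∸ ∣ p ∣) → P p → ∃ λ q → P q × F q ⊆ q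
  go p (acc rec) Pp with p ⊂? F p
  ... | yes p⊂Fp = go (F p) (rec (∸-monoʳ-< (p⊂q⇒∣p∣<∣q∣ p⊂Fp) (∣p∣≤n (F p)))) (P-preserved Pp)
  ... | no  p⊄Fp = p , Pp , Fp⊆p
    where
    Fp⊆p : F p ⊆ p
    Fp⊆p {x} x∈Fp with x ∈? p
    ... | yes x∈p = x∈p
    ... | no  x∉p = ⊥-elim (p⊄Fp (F-inflationary , x , x∈Fp , x∉p))

neighbours : Graph n → Subset n → Subset n
neighbours G A = select (λ w → any? (λ x → (x ∈? A) ×-dec adj? G x w))

module _ {G : Graph n} {A : Subset n} {w : Fin n} where

  ∈-neighbours⁺ : ∀ {x} → x ∈ A → Adj G x w → w ∈ neighbours G A
  ∈-neighbours⁺ x∈A x~w = ∈-select⁺ (λ w → any? (λ x → (x ∈? A) ×-dec adj? G x w)) (_ , x∈A , x~w)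

  ∈-neighbours⁻ : w ∈ neighbours G A → ∃ λ x → x ∈ A × Adj G x w
  ∈-neighbours⁻ = ∈-select⁻ (λ w → any? (λ x → (x ∈? A) ×-dec adj? G x w))

record Component (G : Graph n) (S : Subset n) (u : Fin n) : Set where
  field
    members : Subset n
    root    : u ∈ members
    reach   : ∀ {x} → x ∈ members → Reach G S u x
    closed  : ∀ {x w} → x ∈ members → Adj G x w → w ∉ S → w ∈ members

component : (G : Graph n) (S : Subset n) (u : Fin n) → Component G S u
component G S u = fromClosed (inflationary-closure expand (p⊆p∪q _) Explored preserved (x∈⁅x⁆ u , start))
  where
  expand : Subset _ → Subset _
  expand A = A ∪ (neighbours G A ∩ ∁ S)
  Explored : Subset _ → Set
  Explored A = u ∈ A × (∀ {x} → x ∈ A → Reach G S u x)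
  start : ∀ {x} → x ∈ ⁅ u ⁆ → Reach G S u x
  start x∈⁅u⁆ with refl ← x∈⁅y⁆⇒x≡y u x∈⁅u⁆ = here
  preserved : ∀ {A} → Explored A → Explored (expand A)
  preserved {A} (u∈A , reachA) = p⊆p∪q _ u∈A , reach-expand
    where
    reach-expand : ∀ {x} → x ∈ expand A → Reach G S u x
    reach-expand x∈ with x∈p∪q⁻ A _ x∈
    ... | inj₁ x∈A = reachA x∈A
    ... | inj₂ x∈N∩∁S with x∈N , x∈∁S ← x∈p∩q⁻ _ _ x∈N∩∁S
                     with y , y∈A , y~x ← ∈-neighbours⁻ {G = G} x∈N
      = step (reachA y∈A) y~x (x∈∁p⇒x∉p x∈∁S)
  fromClosed : (∃ λ A → Explored A × expand A ⊆ A) → Component G S u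
  fromClosed (A , (u∈A , reachA) , closedA) = record
    { members = A ; root = u∈A ; reach = reachA
    ; closed  = λ x∈A x~w w∉S →
        closedA (q⊆p∪q A _ (x∈p∩q⁺ (∈-neighbours⁺ {G = G} x∈A x~w , x∉p⇒x∈∁p w∉S))) }

module _ {k p c} {G : Graph (p * c + k)} (ft : FT k p c G)
         {S : Subset (p * c + k)} {u} (C : Component G S u) where
  open Component C

  c∣∣members─T∣ : ∀ {T} → S ⊆ T → ∣ T ∣ ≡ k → c ∣ ∣ members ─ T ∣
  c∣∣members─T∣ {T} S⊆T ∣T∣≡k with f , f-inj , f∉T , clique ← ft T (≤-reflexive ∣T∣≡k) =
    subst (c ∣_) (∣preimage∣≡∣q─t∣ g-inj (f∉T ∘ remQuot {p} c) (cong (p * c +_) ∣T∣≡k) members)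
      (∣∣-blocks p (preimage g members) blocks-closed)
    where
    g : Fin (p * c) → Fin (p * c + k)
    g = f ∘ remQuot {p} c
    g-inj : Injective _≡_ _≡_ g
    g-inj {i} {j} gi≡gj = begin
      i                                 ≡⟨ combine-remQuot {p} c i ⟨
      uncurry combine (remQuot {p} c i) ≡⟨ cong (uncurry combine) (f-inj gi≡gj) ⟩
      uncurry combine (remQuot {p} c j) ≡⟨ combine-remQuot {p} c j ⟩
      j                                 ∎
      where open ≡-Reasoning
    clique-closed : ∀ i a b → f (i , a) ∈ members → f (i , b) ∈ members
    clique-closed i a b fa∈ with a ≟ b
    ... | yes refl = fa∈
    ... | no  a≢b  = closed fa∈ (clique i a b a≢b) (λ fb∈S → f∉T (i , b) (S⊆T fb∈S))
    blocks-closed : ∀ i a b → combine i a ∈ preimage g members → combine i b ∈ preimage g members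
    blocks-closed i a b a∈ = ∈-preimage⁺ {g = g}
      (subst (λ z → f z ∈ members) (sym (remQuot-combine i b))
        (clique-closed i a b
          (subst (λ z → f z ∈ members) (remQuot-combine i a) (∈-preimage⁻ {g = g} a∈))))

  separated⇒c∣1 : ∀ {v} → ∣ S ∣ < k → k < p * c + k → u ∉ S → v ∉ S → u ≢ v → v ∉ members → c ∣ 1
  separated⇒c∣1 {v} ∣S∣<k k<n u∉S v∉S u≢v v∉C
    with R , S⊆R , u∉R , v∉R , 1+∣R∣≡k ← ∃-⊇-avoiding ∣S∣<k k<n u∉S v∉S u≢v =
    ∣m+n∣m⇒∣n (subst (c ∣_) (trans (sym (x∈p⇒suc∣p-x∣≡∣p∣ u∈D)) (+-comm 1 _)) c∣∣D∣) (c∣∣D-x∣ u∉R)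
    where
    D : Subset (p * c + k)
    D = members ─ R
    u∈D : u ∈ D
    u∈D = x∈p∧x∉q⇒x∈p─q root u∉R
    c∣∣D-x∣ : ∀ {x} → x ∉ R → c ∣ ∣ D - x ∣
    c∣∣D-x∣ {x} x∉R = subst (c ∣_) (cong ∣_∣ (p─⁅x⁆∪q≡p─q-x members x R))
      (c∣∣members─T∣ (λ y∈S → q⊆p∪q ⁅ x ⁆ R (S⊆R y∈S)) (trans (x∉p⇒∣⁅x⁆∪p∣≡suc∣p∣ x∉R) 1+∣R∣≡k))
    c∣∣D∣ : c ∣ ∣ D ∣
    c∣∣D∣ = subst (c ∣_) (cong ∣_∣ (x∉p⇒p-x≡p (λ v∈D → v∉C (p─q⊆p members R v∈D)))) (c∣∣D-x∣ v∉R)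

lemma4 : (k p c : ℕ) → 1 ≤ p → 3 ≤ c → (G : Graph (p * c + k))
    → FT k p c G → KConnected k G
lemma4 k p c 1≤p 3≤c G ft = k<n , connected
  where
  k<n : k < p * c + k
  k<n = +-monoˡ-≤ k (*-mono-≤ 1≤p (≤-trans (s≤s z≤n) 3≤c))
  connected : ∀ S → ∣ S ∣ < k → ConnectedWithout G S
  connected S ∣S∣<k u v u∉S v∉S with u ≟ v | v ∈? Component.members (component G S u)
  ... | yes refl | _      = here
  ... | no  _    | yes v∈C = Component.reach (component G S u) v∈C
  ... | no  u≢v  | no v∉C  = ⊥-elim (>⇒≢ (≤-trans (s≤s (s≤s z≤n)) 3≤c)
          (∣1⇒≡1 (separated⇒c∣1 ft (component G S u) ∣S∣<k k<n u∉S v∉S u≢v v∉C)))
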